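{- Let $(\lambda,\mu)$ be an optimal solution to (GS-D) with $\lambda_j > 0$ for all $j \in J$. Let $j \in J$ and $S \in \mathcal{F}_j$. Then $g_j(S) \geq \frac{1}{2} \sum_{i \in S} \frac{\mu_i}{\lambda_j}$.
   Context: Finite sets $J$ (jobs) and $M$ (machines), $C > 0$; for each $j \in J$ an $M^\natural$-concave (in particular submodular) processing speed function $g_j : 2^M \to \mathbb{R}_{\geq 0}$. The LP (GS-D) has variables $\lambda_j$ ($j \in J$), $\mu_i$ ($i \in M$): minimize $-\sum_{j} \lambda_j + C \sum_i \mu_i$ subject to $\big(2 g_j(S) - \frac{1}{C}\big)\lambda_j - \sum_{i \in S}\mu_i \leq 0$ for all $j \in J$ and non-empty $S \subseteq M$, $\mu_i \geq 1$, $\lambda_j \geq 0$. Define $g^*_j(S) := 2 g_j(S) - \sum_{i \in S} \mu_i/\lambda_j$, $\mathcal{D}_j := \operatorname{argmax}_{S \subseteq M} g^*_j(S)$, and $\mathcal{F}_j := \{S \subseteq M : S \subseteq T \text{ for some } T \in \mathcal{D}_j\}$. -}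

module Defs where

open import Level using (0ℓ)
open import Data.Nat using (ℕ; zero; suc)
open import Data.Fin using (Fin; zero; suc)
open import Data.Fin.Subset using (Subset; Side; inside; outside; _∈_; _∉_; _⊆_; Nonempty)
open import Data.Vec using (Vec; []; _∷_; _[_]≔_)
open import Data.Product using (Σ; ∃; _×_; _,_)
open import Data.Sum using (_⊎_)
open import Relation.Binary.PropositionalEquality using (_≡_)
open import Relation.Binary.Structures using (IsTotalOrder)
open import Relation.Nullary using (¬_)
open import Algebra.Structures using (IsCommutativeRing)

-- An ordered field (the reals ℝ are an instance).  Equality is propositional.
-- The inverse _⁻¹ is total; only its value on non-zero arguments is constrained.
record OrderedField : Set₁ where
  infixl 6 _+_ _-_
  infixl 7 _*_
  infix 4 _≤_ _<_
  field
    Carrier : Set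
    _+_ _*_ : Carrier → Carrier → Carrier
    -_ : Carrier → Carrier
    _⁻¹ : Carrier → Carrier
    0# 1# : Carrier
    _≤_ : Carrier → Carrier → Set
    isCommutativeRing : IsCommutativeRing _≡_ _+_ _*_ -_ 0# 1#
    0≢1 : ¬ (0# ≡ 1#)
    ⁻¹-inverse : ∀ x → ¬ (x ≡ 0#) → x * (x ⁻¹) ≡ 1#
    isTotalOrder : IsTotalOrder _≡_ _≤_
    +-mono-≤ : ∀ {x y} z → x ≤ y → x + z ≤ y + z
    *-nonneg : ∀ {x y} → 0# ≤ x → 0# ≤ y → 0# ≤ x * y

  _-_ : Carrier → Carrier → Carrier
  x - y = x + (- y)

  _<_ : Carrier → Carrier → Set
  x < y = x ≤ y × ¬ (x ≡ y)

  2# : Carrier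
  2# = 1# + 1#

module _ (F : OrderedField) where
  open OrderedField F

  sumOver : ∀ {m} → Subset m → (Fin m → Carrier) → Carrier
  sumOver [] f = 0#
  sumOver (outside ∷ S) f = sumOver S (λ i → f (suc i))
  sumOver (inside ∷ S) f = f zero + sumOver S (λ i → f (suc i))

  sumAll : ∀ m → (Fin m → Carrier) → Carrier
  sumAll zero f = 0#
  sumAll (suc m) f = f zero + sumAll m (λ i → f (suc i))

  IsMNatConcave : ∀ {m} → (Subset m → Carrier) → Set
  IsMNatConcave {m} g =
    ∀ (X Y : Subset m) (i : Fin m) → i ∈ X → i ∉ Y →
      (g X + g Y ≤ g (X [ i ]≔ outside) + g (Y [ i ]≔ inside))
      ⊎ (Σ (Fin m) λ k → k ∈ Y × k ∉ X ×
           (g X + g Y ≤ g ((X [ i ]≔ outside) [ k ]≔ inside)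
                           + g ((Y [ i ]≔ inside) [ k ]≔ outside)))

  -- Feasibility for (GS-D); jobs J = Fin n, machines M = Fin m.
  GSD-Feasible : ∀ {n m} → Carrier → (Fin n → Subset m → Carrier)
               → (Fin n → Carrier) → (Fin m → Carrier) → Set
  GSD-Feasible {n} {m} C g λ' μ =
    (∀ (j : Fin n) (S : Subset m) → Nonempty S →
        (2# * g j S - C ⁻¹) * λ' j - sumOver S μ ≤ 0#)
    × (∀ (i : Fin m) → 1# ≤ μ i)
    × (∀ (j : Fin n) → 0# ≤ λ' j)

  GSD-Objective : ∀ {n m} → Carrier → (Fin n → Carrier) → (Fin m → Carrier) → Carrier
  GSD-Objective {n} {m} C λ' μ = - sumAll n λ' + C * sumAll m μ

  GSD-Optimal : ∀ {n m} → Carrier → (Fin n → Subset m → Carrier)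
              → (Fin n → Carrier) → (Fin m → Carrier) → Set
  GSD-Optimal {n} {m} C g λ' μ =
    GSD-Feasible C g λ' μ ×
    (∀ (λ₂ : Fin n → Carrier) (μ₂ : Fin m → Carrier) →
       GSD-Feasible C g λ₂ μ₂ →
       GSD-Objective C λ' μ ≤ GSD-Objective C λ₂ μ₂)

  gStar : ∀ {n m} → (Fin n → Subset m → Carrier) → (Fin n → Carrier) → (Fin m → Carrier)
        → Fin n → Subset m → Carrier
  gStar g λ' μ j S = 2# * g j S - sumOver S (λ i → μ i * (λ' j ⁻¹))

  InD : ∀ {n m} → (Fin n → Subset m → Carrier) → (Fin n → Carrier) → (Fin m → Carrier)
      → Fin n → Subset m → Set
  InD {n} {m} g λ' μ j T = ∀ (S : Subset m) → gStar g λ' μ j S ≤ gStar g λ' μ j T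

  InF : ∀ {n m} → (Fin n → Subset m → Carrier) → (Fin n → Carrier) → (Fin m → Carrier)
      → Fin n → Subset m → Set
  InF {n} {m} g λ' μ j S = Σ (Subset m) λ T → InD g λ' μ j T × S ⊆ T

-- Write φ := g*_j = 2 g_j − w with w(S) = Σ_{i ∈ S} μ_i / λ_j, and let T ∈ 𝒟_j maximise φ.
-- For Y ⊆ T and i ∈ T ∖ Y, the exchange axiom of M♮-concavity cannot take its
-- second form (that needs some k ∈ Y ∖ T), so g_j has diminishing returns:
-- g_j(T) + g_j(Y) ≤ g_j(T − i) + g_j(Y + i).  Since w is modular, φ inherits this,
-- and with φ(T − i) ≤ φ(T) it gives φ(Y) ≤ φ(Y + i).  Hence φ is monotone on the
-- subsets of T, so φ(S) ≥ φ(∅) = 2 g_j(∅) ≥ 0 for S ⊆ T, i.e. w(S) ≤ 2 g_j(S).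
module Submission where

open import Defs
open import Data.Nat using (ℕ)
open import Data.Fin using (Fin)
open import Data.Fin.Subset using (Subset)

open import Level using (0ℓ)
open import Data.Fin using (zero; suc)
open import Data.Fin.Subset using (inside; outside; _∈_; _∉_; _⊆_; _⊂_; ⊥) renaming (_-_ to _without_)
open import Data.Fin.Subset.Properties
  using (p─⊥≡p; x∈p⇒p-x⊂p; ⊆-trans; nonempty?; Empty-unique)
open import Data.Fin.Subset.Induction using (Acc; acc; ⊂-wellFounded)
open import Data.Vec using (_∷_; _[_]≔_; here; there)
open import Data.Vec.Properties using ([]=⇒lookup; []=-injective; []≔-lookup; []≔-updates; []≔-idempotent)
open import Data.Maybe using (nothing)
open import Data.Product using (_,_; proj₁)
open import Data.Sum using (inj₁; inj₂)
open import Relation.Nullary using (¬_; yes; no; contradiction)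
open import Relation.Binary.PropositionalEquality
open import Relation.Binary.Structures using (IsTotalOrder)
open import Algebra.Bundles using (CommutativeRing)
import Tactic.RingSolver.Core.AlmostCommutativeRing as ACR

module OrderedFieldProperties (F : OrderedField) where
  open OrderedField F

  commutativeRing : CommutativeRing 0ℓ 0ℓ
  commutativeRing = record { isCommutativeRing = isCommutativeRing }

  open CommutativeRing commutativeRing public
    using ( +-assoc; +-comm; +-identityˡ; +-identityʳ; -‿inverseʳ; distribˡ
          ; *-assoc; *-comm; *-identityˡ; zeroʳ; ring; +-group; +-abelianGroup )
  open import Algebra.Properties.Ring ring using (-‿distribˡ-*; -‿distribʳ-*; x[y-z]≈xy-xz)
  open import Algebra.Properties.Group +-group using (//-rightDividesˡ; ⁻¹-involutive; ε⁻¹≈ε)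
  open import Algebra.Properties.AbelianGroup +-abelianGroup using (xyx⁻¹≈y)
  open IsTotalOrder isTotalOrder public using (total; antisym) renaming (refl to ≤-refl; trans to ≤-trans)
  open import Tactic.RingSolver.NonReflective (ACR.fromCommutativeRing commutativeRing (λ _ → nothing))
    using (solve; _⊜_; _⊕_; ⊝_)

  +-monoʳ-≤ : ∀ z {x y} → x ≤ y → z + x ≤ z + y
  +-monoʳ-≤ z {x} {y} x≤y = subst₂ _≤_ (+-comm x z) (+-comm y z) (+-mono-≤ z x≤y)

  +-mono-≤₂ : ∀ {x y u v} → x ≤ y → u ≤ v → x + u ≤ y + v
  +-mono-≤₂ {y = y} {u} x≤y u≤v = ≤-trans (+-mono-≤ u x≤y) (+-monoʳ-≤ y u≤v)

  +-cancelˡ-≤ : ∀ z {x y} → z + x ≤ z + y → x ≤ y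
  +-cancelˡ-≤ z {x} {y} z+x≤z+y = subst₂ _≤_ (xyx⁻¹≈y z x) (xyx⁻¹≈y z y) (+-mono-≤ (- z) z+x≤z+y)

  x-0≡x : ∀ x → x - 0# ≡ x
  x-0≡x x = trans (cong (x +_) ε⁻¹≈ε) (+-identityʳ x)

  x≤y⇒0≤y-x : ∀ {x y} → x ≤ y → 0# ≤ y - x
  x≤y⇒0≤y-x {x} x≤y = subst (_≤ _) (-‿inverseʳ x) (+-mono-≤ (- x) x≤y)

  0≤y-x⇒x≤y : ∀ {x y} → 0# ≤ y - x → x ≤ y
  0≤y-x⇒x≤y {x} {y} 0≤y-x = subst₂ _≤_ (+-identityˡ x) (//-rightDividesˡ x y)
                                        (+-mono-≤ x 0≤y-x)

  *-monoˡ-≤-nonneg : ∀ {z x y} → 0# ≤ z → x ≤ y → z * x ≤ z * y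
  *-monoˡ-≤-nonneg {z} {x} {y} 0≤z x≤y = 0≤y-x⇒x≤y (subst (0# ≤_) (x[y-z]≈xy-xz z y x)
                                                          (*-nonneg 0≤z (x≤y⇒0≤y-x x≤y)))

  -x*-x≡x*x : ∀ x → - x * - x ≡ x * x
  -x*-x≡x*x x = begin
    - x * - x      ≡⟨ sym (-‿distribˡ-* x (- x)) ⟩
    - (x * - x)    ≡⟨ cong -_ (sym (-‿distribʳ-* x x)) ⟩
    - (- (x * x))  ≡⟨ ⁻¹-involutive (x * x) ⟩
    x * x          ∎
    where open ≡-Reasoning

  0≤x*x : ∀ x → 0# ≤ x * x
  0≤x*x x with total 0# x
  ... | inj₁ 0≤x = *-nonneg 0≤x 0≤x
  ... | inj₂ x≤0 = subst (0# ≤_) (-x*-x≡x*x x) (*-nonneg 0≤-x 0≤-x)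
    where
    0≤-x : 0# ≤ - x
    0≤-x = subst (0# ≤_) (+-identityˡ (- x)) (x≤y⇒0≤y-x x≤0)

  0≤1 : 0# ≤ 1#
  0≤1 = subst (0# ≤_) (*-identityˡ 1#) (0≤x*x 1#)

  0≤2 : 0# ≤ 2#
  0≤2 = subst (_≤ 2#) (+-identityˡ 0#) (+-mono-≤₂ 0≤1 0≤1)

  2≢0 : ¬ (2# ≡ 0#)
  2≢0 2≡0 = 0≢1 (antisym 0≤1 (subst (1# ≤_) 2≡0 1≤2))
    where
    1≤2 : 1# ≤ 2#
    1≤2 = subst (_≤ 2#) (+-identityˡ 1#) (+-mono-≤ 1# 0≤1)

  0≤2⁻¹ : 0# ≤ 2# ⁻¹
  0≤2⁻¹ with total 0# (2# ⁻¹)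
  ... | inj₁ 0≤2⁻¹ = 0≤2⁻¹
  ... | inj₂ 2⁻¹≤0 = contradiction (antisym 0≤1 1≤0) 0≢1
    where
    1≤0 : 1# ≤ 0#
    1≤0 = subst₂ _≤_ (⁻¹-inverse 2# 2≢0) (zeroʳ 2#) (*-monoˡ-≤-nonneg 0≤2 2⁻¹≤0)

  halve : ∀ {x y} → x ≤ 2# * y → 2# ⁻¹ * x ≤ y
  halve {x} {y} x≤2y = subst (2# ⁻¹ * x ≤_) 2⁻¹*[2*y]≡y (*-monoˡ-≤-nonneg 0≤2⁻¹ x≤2y)
    where
    2⁻¹*[2*y]≡y : 2# ⁻¹ * (2# * y) ≡ y
    2⁻¹*[2*y]≡y = begin
      2# ⁻¹ * (2# * y)   ≡⟨ sym (*-assoc (2# ⁻¹) 2# y) ⟩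
      2# ⁻¹ * 2# * y     ≡⟨ cong (_* y) (*-comm (2# ⁻¹) 2#) ⟩
      2# * 2# ⁻¹ * y     ≡⟨ cong (_* y) (⁻¹-inverse 2# 2≢0) ⟩
      1# * y             ≡⟨ *-identityˡ y ⟩
      y                  ∎
      where open ≡-Reasoning

  differences-mono-≤ : ∀ {a b a′ b′ x y x′ y′} → a + b ≤ a′ + b′ → x + y ≡ x′ + y′ →
                       (a - x) + (b - y) ≤ (a′ - x′) + (b′ - y′)
  differences-mono-≤ {a} {b} {a′} {b′} {x} {y} {x′} {y′} ab≤ab′ xy≡xy′ =
    subst₂ _≤_ (regroup a b x y) (trans (cong (λ z → a′ + b′ - z) xy≡xy′) (regroup a′ b′ x′ y′))
               (+-mono-≤ (- (x + y)) ab≤ab′)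
    where
    regroup : ∀ a b x y → a + b - (x + y) ≡ (a - x) + (b - y)
    regroup = solve 4 (λ a b x y → ((a ⊕ b) ⊕ (⊝ (x ⊕ y))) ⊜ ((a ⊕ (⊝ x)) ⊕ (b ⊕ (⊝ y)))) refl

p[x]≔outside≡p-x : ∀ {m} (p : Subset m) x → p [ x ]≔ outside ≡ p without x
p[x]≔outside≡p-x (_ ∷ p) zero    = cong (outside ∷_) (sym (p─⊥≡p p))
p[x]≔outside≡p-x (s ∷ p) (suc x) = cong (s ∷_) (p[x]≔outside≡p-x p x)

x∈p⇒p[x]≔outside⊂p : ∀ {m} {p : Subset m} {x} → x ∈ p → p [ x ]≔ outside ⊂ p
x∈p⇒p[x]≔outside⊂p {p = p} {x} x∈p = subst (_⊂ p) (sym (p[x]≔outside≡p-x p x)) (x∈p⇒p-x⊂p x∈p)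

x∉p[x]≔outside : ∀ {m} (p : Subset m) x → x ∉ p [ x ]≔ outside
x∉p[x]≔outside p x x∈ with () ← []=-injective ([]≔-updates p x) x∈

x∈p⇒p[x]≔inside≡p : ∀ {m} {p : Subset m} {x} → x ∈ p → p [ x ]≔ inside ≡ p
x∈p⇒p[x]≔inside≡p {p = p} {x} x∈p = trans (cong (p [ x ]≔_) (sym ([]=⇒lookup x∈p))) ([]≔-lookup p x)

module _ (F : OrderedField) where
  open OrderedField F
  open OrderedFieldProperties F

  sumOver-⊥ : ∀ {m} (f : Fin m → Carrier) → sumOver F ⊥ f ≡ 0#
  sumOver-⊥ {ℕ.zero}  f = refl
  sumOver-⊥ {ℕ.suc m} f = sumOver-⊥ (λ i → f (suc i))

  sumOver-remove : ∀ {m} {p : Subset m} {x} (f : Fin m → Carrier) → x ∈ p →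
                   sumOver F p f ≡ sumOver F (p [ x ]≔ outside) f + f x
  sumOver-remove f here = +-comm (f zero) _
  sumOver-remove {p = outside ∷ p} f (there x∈p) = sumOver-remove (λ i → f (suc i)) x∈p
  sumOver-remove {p = inside ∷ p}  f (there x∈p) =
    trans (cong (f zero +_) (sumOver-remove (λ i → f (suc i)) x∈p)) (sym (+-assoc (f zero) _ _))

  sumOver-exchange : ∀ {m} {p q : Subset m} {x} (f : Fin m → Carrier) → x ∈ p → x ∈ q →
                     sumOver F p f + sumOver F (q [ x ]≔ outside) f
                     ≡ sumOver F (p [ x ]≔ outside) f + sumOver F q f
  sumOver-exchange {p = p} {q} {x} f x∈p x∈q = begin
    Σp + Σq′             ≡⟨ cong (_+ Σq′) (sumOver-remove f x∈p) ⟩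
    Σp′ + f x + Σq′      ≡⟨ +-assoc Σp′ (f x) Σq′ ⟩
    Σp′ + (f x + Σq′)    ≡⟨ cong (Σp′ +_) (+-comm (f x) Σq′) ⟩
    Σp′ + (Σq′ + f x)    ≡⟨ cong (Σp′ +_) (sym (sumOver-remove f x∈q)) ⟩
    Σp′ + Σq             ∎
    where
    open ≡-Reasoning
    Σp Σq Σp′ Σq′ : Carrier
    Σp = sumOver F p f
    Σq = sumOver F q f
    Σp′ = sumOver F (p [ x ]≔ outside) f
    Σq′ = sumOver F (q [ x ]≔ outside) f

  DiminishingReturnsBelow : ∀ {m} → (Subset m → Carrier) → Subset m → Set
  DiminishingReturnsBelow h X = ∀ S i → S ⊆ X → i ∈ S →
    h X + h (S [ i ]≔ outside) ≤ h (X [ i ]≔ outside) + h S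

  isMNatConcave⇒diminishingReturnsBelow : ∀ {m} {g : Subset m → Carrier} →
    IsMNatConcave F g → ∀ X → DiminishingReturnsBelow g X
  isMNatConcave⇒diminishingReturnsBelow {g = g} g-concave X S i S⊆X i∈S
    with g-concave X (S [ i ]≔ outside) i (S⊆X i∈S) (x∉p[x]≔outside S i)
  ... | inj₁ exchange = subst (λ S′ → g X + g (S [ i ]≔ outside) ≤ g (X [ i ]≔ outside) + g S′)
                              (trans ([]≔-idempotent S i) (x∈p⇒p[x]≔inside≡p i∈S)) exchange
  ... | inj₂ (k , k∈S-i , k∉X , _) = contradiction (S⊆X (proj₁ (x∈p⇒p[x]≔outside⊂p i∈S) k∈S-i)) k∉X

  diminishingReturnsBelow-scale : ∀ {m} {h : Subset m → Carrier} {X c} → 0# ≤ c →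
    DiminishingReturnsBelow h X → DiminishingReturnsBelow (λ S → c * h S) X
  diminishingReturnsBelow-scale {c = c} 0≤c h-dr S i S⊆X i∈S =
    subst₂ _≤_ (distribˡ c _ _) (distribˡ c _ _) (*-monoˡ-≤-nonneg 0≤c (h-dr S i S⊆X i∈S))

  diminishingReturnsBelow-minusSum : ∀ {m} {h : Subset m → Carrier} {X} (f : Fin m → Carrier) →
    DiminishingReturnsBelow h X → DiminishingReturnsBelow (λ S → h S - sumOver F S f) X
  diminishingReturnsBelow-minusSum f h-dr S i S⊆X i∈S =
    differences-mono-≤ (h-dr S i S⊆X i∈S) (sumOver-exchange f (S⊆X i∈S) i∈S)

  module _ {m} (φ : Subset m → Carrier) (T : Subset m)
           (T-maximal : ∀ S → φ S ≤ φ T) (φ-dr : DiminishingReturnsBelow φ T) where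

    maximiser-remove-≤ : ∀ {S i} → S ⊆ T → i ∈ S → φ (S [ i ]≔ outside) ≤ φ S
    maximiser-remove-≤ {S} {i} S⊆T i∈S = +-cancelˡ-≤ (φ T)
      (≤-trans (φ-dr S i S⊆T i∈S) (+-mono-≤ (φ S) (T-maximal (T [ i ]≔ outside))))

    maximiser-monotoneBelow : ∀ S → S ⊆ T → φ ⊥ ≤ φ S
    maximiser-monotoneBelow S = go S (⊂-wellFounded S)
      where
      go : ∀ S → Acc _⊂_ S → S ⊆ T → φ ⊥ ≤ φ S
      go S (acc rec) S⊆T with nonempty? S
      ... | no S-empty rewrite Empty-unique S-empty = ≤-refl
      ... | yes (i , i∈S) = ≤-trans (go (S [ i ]≔ outside) (rec S-i⊂S) (⊆-trans (proj₁ S-i⊂S) S⊆T))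
                                    (maximiser-remove-≤ S⊆T i∈S)
        where
        S-i⊂S : S [ i ]≔ outside ⊂ S
        S-i⊂S = x∈p⇒p[x]≔outside⊂p i∈S

lemma4 : (F : OrderedField) → let open OrderedField F in
    (n m : ℕ) (C : Carrier) → 0# < C →
    (g : Fin n → Subset m → Carrier) →
    (∀ j S → 0# ≤ g j S) →
    (∀ j → IsMNatConcave F (g j)) →
    (λ' : Fin n → Carrier) (μ : Fin m → Carrier) →
    GSD-Optimal F C g λ' μ →
    (∀ j → 0# < λ' j) →
    (j : Fin n) (S : Subset m) → InF F g λ' μ j S →
    (2# ⁻¹) * sumOver F S (λ i → μ i * (λ' j ⁻¹)) ≤ g j S
lemma4 F n m C _ g g≥0 g-concave λ' μ _ _ j S (T , T∈𝒟 , S⊆T) =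
  halve (0≤y-x⇒x≤y (≤-trans 0≤φ⊥ (maximiser-monotoneBelow F φ T T∈𝒟 φ-dr S S⊆T)))
  where
  open OrderedField F
  open OrderedFieldProperties F
  w : Fin m → Carrier
  w i = μ i * (λ' j ⁻¹)
  φ : Subset m → Carrier
  φ = gStar F g λ' μ j
  φ-dr : DiminishingReturnsBelow F φ T
  φ-dr = diminishingReturnsBelow-minusSum F w
           (diminishingReturnsBelow-scale F 0≤2 (isMNatConcave⇒diminishingReturnsBelow F (g-concave j) T))
  0≤φ⊥ : 0# ≤ φ ⊥
  0≤φ⊥ = subst (0# ≤_) (sym φ⊥≡2g⊥) (*-nonneg 0≤2 (g≥0 j ⊥))
    where
    φ⊥≡2g⊥ : φ ⊥ ≡ 2# * g j ⊥
    φ⊥≡2g⊥ = trans (cong (λ s → 2# * g j ⊥ - s) (sumOver-⊥ F w)) (x-0≡x (2# * g j ⊥))
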